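{- For a positive integer $n$, let $H(n)$ be the number of permutations of $[n]=\{1,\dots,n\}$ that are not locally parallel to the identity permutation. Then $H(n)\le 6^n$.
   Context: A permutation of $[n]$ is a bijection $[n]\to[n]$; for a permutation $\sigma$ and $a\in[n]$, $\sigma^{ -1}(a)$ is the position of $a$ when $\sigma$ is viewed as the linear order $\sigma(1),\dots,\sigma(n)$. Two permutations $\sigma,\tau$ of $[n]$ are called locally parallel if there exist two distinct elements $a,b\in[n]$ such that $\sigma^{ -1}(a)<\sigma^{ -1}(b)$, $\tau^{ -1}(b)<\tau^{ -1}(a)$, and $[\sigma^{ -1}(a),\sigma^{ -1}(b)]\cap[\tau^{ -1}(b),\tau^{ -1}(a)]=\emptyset$ (intervals of integers/positions). -}

module Defs where

open import Data.Nat using (ℕ; zero; suc)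
open import Data.Fin using (Fin; _<_; _≤_; _≟_)
open import Data.Fin.Properties using (any?; all?; _<?_)
open import Data.Vec using (Vec; []; _∷_; lookup)
open import Data.List using (List; []; _∷_; concatMap; map; filter; length; allFin)
open import Data.Product using (∃; _×_; _,_)
open import Relation.Nullary using (¬_; Dec; yes; no)
open import Relation.Nullary.Decidable using (_×-dec_; ¬?; _→-dec_)
open import Relation.Binary.PropositionalEquality using (_≡_; _≢_)

-- A permutation of [n] is represented in one-line notation as the vector
-- (σ(1), …, σ(n)) : Vec (Fin n) n, i.e. positions ↦ values; it is a
-- permutation iff the entries are pairwise distinct (injective ⇒ bijective
-- on a finite set).
IsPerm : ∀ {n} → Vec (Fin n) n → Set
IsPerm {n} σ = ∀ (i j : Fin n) → lookup σ i ≡ lookup σ j → i ≡ j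

idPerm : ∀ n → Vec (Fin n) n
idPerm n = Data.Vec.allFin n

-- Integer interval [x,y] of positions (x ≤ y) meets [u,v] (u ≤ v)
-- iff x ≤ v and u ≤ y.  Disjointness of the intervals:
Disjoint : ∀ {n} → Fin n → Fin n → Fin n → Fin n → Set
Disjoint x y u v = ¬ ((x ≤ v) × (u ≤ y))

-- σ and τ are locally parallel: there are distinct values a, b with
-- σ⁻¹(a) < σ⁻¹(b), τ⁻¹(b) < τ⁻¹(a) and [σ⁻¹(a),σ⁻¹(b)] ∩ [τ⁻¹(b),τ⁻¹(a)] = ∅.
-- Positions p = σ⁻¹(a), q = σ⁻¹(b), r = τ⁻¹(b), s = τ⁻¹(a)
-- are described by  lookup σ p ≡ a  etc.
LocallyParallel : ∀ {n} → Vec (Fin n) n → Vec (Fin n) n → Set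
LocallyParallel {n} σ τ =
  ∃ λ (a : Fin n) → ∃ λ (b : Fin n) →
  ∃ λ (p : Fin n) → ∃ λ (q : Fin n) → ∃ λ (r : Fin n) → ∃ λ (s : Fin n) →
    (a ≢ b) ×
    (lookup σ p ≡ a) × (lookup σ q ≡ b) × (lookup τ r ≡ b) × (lookup τ s ≡ a) ×
    (p < q) × (r < s) × Disjoint p q r s

_≤?_ : ∀ {n} (x y : Fin n) → Dec (x ≤ y)
x ≤? y = Data.Fin.Properties._≤?_ x y

isPerm? : ∀ {n} (σ : Vec (Fin n) n) → Dec (IsPerm σ)
isPerm? σ = all? λ i → all? λ j → (lookup σ i ≟ lookup σ j) →-dec (i ≟ j)

locallyParallel? : ∀ {n} (σ τ : Vec (Fin n) n) → Dec (LocallyParallel σ τ)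
locallyParallel? σ τ =
  any? λ a → any? λ b → any? λ p → any? λ q → any? λ r → any? λ s →
    ¬? (a ≟ b) ×-dec
    (lookup σ p ≟ a) ×-dec (lookup σ q ≟ b) ×-dec (lookup τ r ≟ b) ×-dec (lookup τ s ≟ a) ×-dec
    (p <? q) ×-dec (r <? s) ×-dec ¬? ((p ≤? s) ×-dec (r ≤? q))

allVecs : ∀ n k → List (Vec (Fin n) k)
allVecs n zero = [] ∷ []
allVecs n (suc k) = concatMap (λ x → map (x ∷_) (allVecs n k)) (allFin n)

NotLPId? : ∀ {n} (σ : Vec (Fin n) n) → Dec (IsPerm σ × ¬ LocallyParallel σ (idPerm n))
NotLPId? {n} σ = isPerm? σ ×-dec ¬? (locallyParallel? σ (idPerm n))

H : ℕ → ℕ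
H n = length (filter NotLPId? (allVecs n n))

-- Record, for each index i of a permutation σ, whether σ(i) is below, at or
-- above i, and whether the value i stands to the right of position i. This
-- is one of 3 · 2 = 6 symbols, so it suffices to show that the word of n
-- symbols determines σ among permutations not locally parallel to the
-- identity. For those, every inversion p < q satisfies p ≤ σ(p) and
-- σ(q) ≤ q. If σ and τ share their word and first differ at p, say
-- σ(p) < τ(p), then the value σ(p) sits at some position q > p of τ, which
-- makes p < q an inversion of τ; comparing the two symbols at p and at q
-- with the inequalities above gives a contradiction in every case.
module Submission where

open import Defs
open import Data.Nat as ℕ using (ℕ; suc; _≤_; _^_; z≤n; s≤s)
import Data.Nat.Properties as ℕP
open import Data.Fin as F using (Fin; punchOut; combine)
open import Data.Fin.Properties as FP
  using (<-cmp; _≟_; any?; punchOut-injective; combine-injective; injective⇒≤)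
open import Data.Fin.Induction using (<-wellFounded)
open import Data.Vec as V using (Vec; lookup; tabulate)
open import Data.Vec.Properties as VP using (lookup∘tabulate; lookup-allFin)
open import Data.List as L using (List; length; filter; allFin; concatMap)
import Data.List.Properties as LP
open import Data.List.Membership.Propositional using (_∈_)
open import Data.List.Membership.Propositional.Properties
  using (∈-∃++; ∈-++⁻; ∈-++⁺ˡ; ∈-++⁺ʳ; ∈-concat⁺′; ∈-map⁺; ∈-map⁻; ∈-allFin; ∈-filter⁻)
open import Data.List.Relation.Unary.Any using (here; there)
open import Data.List.Relation.Unary.All as All using (All)
import Data.List.Relation.Unary.All.Properties as AllP
open import Data.List.Relation.Unary.AllPairs as AP using (AllPairs)
import Data.List.Relation.Unary.AllPairs.Properties as APP
open import Data.List.Relation.Unary.Unique.Propositional using (Unique)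
import Data.List.Relation.Unary.Unique.Propositional.Properties as UP
open import Data.List.Relation.Binary.Disjoint.Propositional
  renaming (Disjoint to DisjointLists)
open import Data.Product using (∃; _×_; _,_; proj₁; proj₂)
open import Data.Sum using (inj₁; inj₂)
open import Data.Empty using (⊥-elim)
open import Relation.Nullary using (¬_; Dec; yes; no; contradiction)
open import Relation.Nullary.Decidable using (_×-dec_; decidable-stable)
open import Relation.Binary.Definitions using (Tri; tri<; tri≈; tri>)
open import Relation.Binary.PropositionalEquality
import Induction.WellFounded as WF
open import Function using (_∘_; id)

length-≤-of-injectiveOn : ∀ {A B : Set} (f : A → B) {xs : List A} {ys : List B} →
  Unique xs → (∀ {x y} → x ∈ xs → y ∈ xs → f x ≡ f y → x ≡ y) →
  (∀ {x} → x ∈ xs → f x ∈ ys) → length xs ≤ length ys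
length-≤-of-injectiveOn f {L.[]} _ _ _ = z≤n
length-≤-of-injectiveOn f {x L.∷ xs} (x∉xs AP.∷ xs-unique) inj maps
  with ys₁ , ys₂ , refl ← ∈-∃++ (maps (here refl)) = begin
    suc (length xs)                   ≤⟨ s≤s (length-≤-of-injectiveOn f xs-unique
                                              (λ p q → inj (there p) (there q)) maps-rest) ⟩
    suc (length (ys₁ L.++ ys₂))       ≡⟨ cong suc (LP.length-++ ys₁) ⟩
    suc (length ys₁ ℕ.+ length ys₂)   ≡⟨ ℕP.+-suc (length ys₁) (length ys₂) ⟨
    length ys₁ ℕ.+ suc (length ys₂)   ≡⟨ LP.length-++ ys₁ ⟨
    length (ys₁ L.++ f x L.∷ ys₂)     ∎
  where
  open ℕP.≤-Reasoning
  maps-rest : ∀ {z} → z ∈ xs → f z ∈ ys₁ L.++ ys₂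
  maps-rest {z} z∈xs with ∈-++⁻ ys₁ (maps (there z∈xs))
  ... | inj₁ fz∈ys₁         = ∈-++⁺ˡ fz∈ys₁
  ... | inj₂ (here fz≡fx)   = ⊥-elim (All.lookup x∉xs z∈xs (inj (here refl) (there z∈xs) (sym fz≡fx)))
  ... | inj₂ (there fz∈ys₂) = ∈-++⁺ʳ ys₁ fz∈ys₂

∈-allVecs : ∀ m k (v : Vec (Fin m) k) → v ∈ allVecs m k
∈-allVecs m 0       V.[]       = here refl
∈-allVecs m (suc k) (x V.∷ v) =
  ∈-concat⁺′ (∈-map⁺ (x V.∷_) (∈-allVecs m k v))
             (∈-map⁺ (λ y → L.map (y V.∷_) (allVecs m k)) (∈-allFin x))

length-concatMap-cons : ∀ {m k} (xs : List (Fin m)) (vs : List (Vec (Fin m) k)) →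
  length (concatMap (λ x → L.map (x V.∷_) vs) xs) ≡ length xs ℕ.* length vs
length-concatMap-cons L.[]       vs = refl
length-concatMap-cons (x L.∷ xs) vs = trans (LP.length-++ (L.map (x V.∷_) vs))
  (cong₂ ℕ._+_ (LP.length-map (x V.∷_) vs) (length-concatMap-cons xs vs))

length-allVecs : ∀ m k → length (allVecs m k) ≡ m ^ k
length-allVecs m 0       = refl
length-allVecs m (suc k) = trans (length-concatMap-cons (allFin m) (allVecs m k))
  (cong₂ ℕ._*_ (LP.length-tabulate {n = m} id) (length-allVecs m k))

allVecs-unique : ∀ m k → Unique (allVecs m k)
allVecs-unique m 0       = All.[] AP.∷ AP.[]
allVecs-unique m (suc k) = UP.concat⁺ blocks-unique blocks-disjoint
  where
  block : Fin m → List (Vec (Fin m) (suc k))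
  block x = L.map (x V.∷_) (allVecs m k)
  blocks-unique : All Unique (L.map block (allFin m))
  blocks-unique = AllP.map⁺ (All.tabulate λ _ →
    UP.map⁺ VP.∷-injectiveʳ (allVecs-unique m k))
  different-heads : ∀ {x y} → x ≢ y → DisjointLists (block x) (block y)
  different-heads x≢y (v∈ , w∈) with ∈-map⁻ _ v∈ | ∈-map⁻ _ w∈
  ... | _ , _ , refl | _ , _ , eq = x≢y (VP.∷-injectiveˡ eq)
  blocks-disjoint : AllPairs DisjointLists (L.map block (allFin m))
  blocks-disjoint = APP.map⁺ (AP.map different-heads (UP.allFin⁺ m))

perm-surjective : ∀ {n} (σ : Vec (Fin n) n) → IsPerm σ → ∀ v → ∃ λ p → lookup σ p ≡ v
perm-surjective {0}     _ _ ()
perm-surjective {suc m} σ σ-inj v with any? (λ p → lookup σ p ≟ v)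
... | yes hit = hit
... | no miss = contradiction (injective⇒≤ squeeze-injective) (ℕP.n≮n m)
  where
  squeeze : Fin (suc m) → Fin m
  squeeze p = punchOut {i = v} (λ eq → miss (p , sym eq))
  squeeze-injective : ∀ {p q} → squeeze p ≡ squeeze q → p ≡ q
  squeeze-injective {p} {q} eq = σ-inj p q (punchOut-injective {i = v} _ _ eq)

triCode : ∀ {a b c} {A : Set a} {B : Set b} {C : Set c} → Tri A B C → Fin 3
triCode (tri< _ _ _) = F.zero
triCode (tri≈ _ _ _) = F.suc F.zero
triCode (tri> _ _ _) = F.suc (F.suc F.zero)

module _ {a b c a′ b′ c′} {A : Set a} {B : Set b} {C : Set c}
         {A′ : Set a′} {B′ : Set b′} {C′ : Set c′} where

  triCode-transfer< : (t : Tri A B C) (t′ : Tri A′ B′ C′) → triCode t ≡ triCode t′ → A → A′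
  triCode-transfer< _              (tri< a′ _ _) _  _ = a′
  triCode-transfer< (tri< _ _ _)   (tri≈ _ _ _)  () _
  triCode-transfer< (tri< _ _ _)   (tri> _ _ _)  () _
  triCode-transfer< (tri≈ ¬a _ _)  _             _  a = contradiction a ¬a
  triCode-transfer< (tri> ¬a _ _)  _             _  a = contradiction a ¬a

  triCode-transfer≈ : (t : Tri A B C) (t′ : Tri A′ B′ C′) → triCode t ≡ triCode t′ → B → B′
  triCode-transfer≈ _              (tri≈ _ b′ _) _  _ = b′
  triCode-transfer≈ (tri≈ _ _ _)   (tri< _ _ _)  () _
  triCode-transfer≈ (tri≈ _ _ _)   (tri> _ _ _)  () _
  triCode-transfer≈ (tri< _ ¬b _)  _             _  b = contradiction b ¬b
  triCode-transfer≈ (tri> _ ¬b _)  _             _  b = contradiction b ¬b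

decCode : ∀ {a} {A : Set a} → Dec A → Fin 2
decCode (yes _) = F.suc F.zero
decCode (no _)  = F.zero

module _ {a b} {A : Set a} {B : Set b} where

  decCode-transfer : (A? : Dec A) (B? : Dec B) → decCode A? ≡ decCode B? → A → B
  decCode-transfer _      (yes b) _  _ = b
  decCode-transfer (yes _) (no _) () _
  decCode-transfer (no ¬a) (no _) _  a = contradiction a ¬a

module _ {n : ℕ} where

  displacement : Vec (Fin n) n → Fin n → Fin 3
  displacement σ i = triCode (<-cmp (lookup σ i) i)

  MovedLeft : Vec (Fin n) n → Fin n → Set
  MovedLeft σ v = ∃ λ p → (lookup σ p ≡ v) × (lookup σ p F.< p)

  movedLeft? : (σ : Vec (Fin n) n) (v : Fin n) → Dec (MovedLeft σ v)
  movedLeft? σ v = any? λ p → (lookup σ p ≟ v) ×-dec (lookup σ p FP.<? p)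

  code : Vec (Fin n) n → Vec (Fin 6) n
  code σ = tabulate λ i → combine (displacement σ i) (decCode (movedLeft? σ i))

  NotLocallyParallelToId : Vec (Fin n) n → Set
  NotLocallyParallelToId σ = ¬ LocallyParallel σ (idPerm n)

  inversion-overlaps : ∀ σ → NotLocallyParallelToId σ → ∀ {p q} → p F.< q →
    lookup σ q F.< lookup σ p → (p F.≤ lookup σ p) × (lookup σ q F.≤ q)
  inversion-overlaps σ notLP {p} {q} p<q inv =
    decidable-stable ((p ≤? lookup σ p) ×-dec (lookup σ q ≤? q)) λ disjoint →
      notLP (lookup σ p , lookup σ q , p , q , lookup σ q , lookup σ p ,
             (λ eq → FP.<-irrefl (sym eq) inv) , refl , refl ,
             lookup-allFin _ , lookup-allFin _ , p<q , inv , disjoint)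

  module SameCode {σ τ : Vec (Fin n) n} (same : code σ ≡ code τ) where

    private
      symbols : ∀ i → displacement σ i ≡ displacement τ i ×
                      decCode (movedLeft? σ i) ≡ decCode (movedLeft? τ i)
      symbols i = combine-injective _ _ _ _ (begin
        combine (displacement σ i) (decCode (movedLeft? σ i)) ≡⟨ lookup∘tabulate _ i ⟨
        lookup (code σ) i                                     ≡⟨ cong (λ c → lookup c i) same ⟩
        lookup (code τ) i                                     ≡⟨ lookup∘tabulate _ i ⟩
        combine (displacement τ i) (decCode (movedLeft? τ i)) ∎)
        where open ≡-Reasoning

    below-transfer : ∀ {i} → lookup σ i F.< i → lookup τ i F.< i
    below-transfer {i} = triCode-transfer< (<-cmp _ i) (<-cmp _ i) (proj₁ (symbols i))

    fixed-transfer : ∀ {i} → lookup σ i ≡ i → lookup τ i ≡ i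
    fixed-transfer {i} = triCode-transfer≈ (<-cmp _ i) (<-cmp _ i) (proj₁ (symbols i))

    movedLeft-transfer : ∀ {v} → MovedLeft σ v → MovedLeft τ v
    movedLeft-transfer {v} = decCode-transfer (movedLeft? σ v) (movedLeft? τ v) (proj₂ (symbols v))

  module FirstDifference {σ τ : Vec (Fin n) n} (σ-perm : IsPerm σ) (τ-perm : IsPerm τ)
    (τ-notLP : NotLocallyParallelToId τ) (same : code σ ≡ code τ)
    {p : Fin n} (agree-before : ∀ {j} → j F.< p → lookup σ j ≡ lookup τ j) where

    open SameCode {σ} {τ} same
    open SameCode {τ} {σ} (sym same) using ()
      renaming (fixed-transfer to fixed-transfer⁻¹; movedLeft-transfer to movedLeft-transfer⁻¹)

    τ-position-after : ∀ {q} → lookup τ q ≡ lookup σ p → lookup σ p ≢ lookup τ p → p F.< q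
    τ-position-after {q} τq≡σp σp≢τp with <-cmp q p
    ... | tri< q<p _ _   = contradiction (σ-perm q p (trans (agree-before q<p) τq≡σp)) (FP.<⇒≢ q<p)
    ... | tri≈ _ refl _  = contradiction (sym τq≡σp) σp≢τp
    ... | tri> _ _ p<q   = p<q

    τ-inversion-overlaps : ∀ {q} → lookup τ q ≡ lookup σ p → lookup σ p F.< lookup τ p →
      p F.< q × (p F.≤ lookup τ p) × (lookup τ q F.≤ q)
    τ-inversion-overlaps τq≡σp σp<τp =
      p<q , inversion-overlaps τ τ-notLP p<q (subst (F._< lookup τ p) (sym τq≡σp) σp<τp)
      where p<q = τ-position-after τq≡σp (FP.<⇒≢ σp<τp)

    below-not-smaller : lookup σ p F.< p → ¬ (lookup σ p F.< lookup τ p)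
    below-not-smaller σp<p σp<τp =
      let q , τq≡σp , _ = movedLeft-transfer (p , refl , σp<p)
          _ , p≤τp , _ = τ-inversion-overlaps τq≡σp σp<τp
      in ℕP.<⇒≱ (below-transfer σp<p) p≤τp

    above-not-smaller : p F.< lookup σ p → ¬ (lookup σ p F.< lookup τ p)
    above-not-smaller p<σp σp<τp with perm-surjective τ τ-perm (lookup σ p)
    ... | q , τq≡σp with τ-inversion-overlaps τq≡σp σp<τp | <-cmp (lookup τ q) q
    ... | _ , _ , τq≤q | tri> _ _ q<τq = ℕP.<⇒≱ q<τq τq≤q
    ... | p<q , _      | tri≈ _ τq≡q _ = FP.<⇒≢ p<q (sym (σ-perm q p (begin
      lookup σ q ≡⟨ fixed-transfer⁻¹ τq≡q ⟩
      q          ≡⟨ τq≡q ⟨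
      lookup τ q ≡⟨ τq≡σp ⟩
      lookup σ p ∎)))
      where open ≡-Reasoning
    ... | _            | tri< τq<q _ _ =
      let r , σr≡σp , σr<r = movedLeft-transfer⁻¹ (q , τq≡σp , τq<q)
      in ℕP.<-asym p<σp (subst (λ x → lookup σ x F.< x) (σ-perm r p σr≡σp) σr<r)

    not-smaller : ¬ (lookup σ p F.< lookup τ p)
    not-smaller with <-cmp (lookup σ p) p
    ... | tri< σp<p _ _ = below-not-smaller σp<p
    ... | tri≈ _ σp≡p _ = FP.<-irrefl (trans σp≡p (sym (fixed-transfer σp≡p)))
    ... | tri> _ _ p<σp = above-not-smaller p<σp

  code-injective : ∀ {σ τ} → IsPerm σ → IsPerm τ →
    NotLocallyParallelToId σ → NotLocallyParallelToId τ → code σ ≡ code τ → σ ≡ τ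
  code-injective {σ} {τ} σ-perm τ-perm σ-notLP τ-notLP same = begin
    σ                   ≡⟨ VP.tabulate∘lookup σ ⟨
    tabulate (lookup σ) ≡⟨ VP.tabulate-cong (WF.All.wfRec <-wellFounded _ Agree agree-at) ⟩
    tabulate (lookup τ) ≡⟨ VP.tabulate∘lookup τ ⟩
    τ                   ∎
    where
    open ≡-Reasoning
    Agree : Fin n → Set
    Agree i = lookup σ i ≡ lookup τ i
    agree-at : ∀ p → (∀ {j} → j F.< p → Agree j) → Agree p
    agree-at p agree-before with <-cmp (lookup σ p) (lookup τ p)
    ... | tri< σp<τp _ _ = contradiction σp<τp
      (FirstDifference.not-smaller {σ} {τ} σ-perm τ-perm τ-notLP same agree-before)
    ... | tri≈ _ σp≡τp _ = σp≡τp
    ... | tri> _ _ τp<σp = contradiction τp<σp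
      (FirstDifference.not-smaller {τ} {σ} τ-perm σ-perm σ-notLP (sym same) (sym ∘ agree-before))

lemma2 : (n : ℕ) → 1 ≤ n → H n ≤ 6 ^ n
lemma2 n _ = begin
  H n                   ≤⟨ length-≤-of-injectiveOn code
                             (UP.filter⁺ NotLPId? (allVecs-unique n n))
                             (λ σ∈ τ∈ → code-injective (proj₁ (counted σ∈)) (proj₁ (counted τ∈))
                                                       (proj₂ (counted σ∈)) (proj₂ (counted τ∈)))
                             (λ _ → ∈-allVecs 6 n _) ⟩
  length (allVecs 6 n)  ≡⟨ length-allVecs 6 n ⟩
  6 ^ n                 ∎
  where
  open ℕP.≤-Reasoning
  counted : ∀ {σ} → σ ∈ filter NotLPId? (allVecs n n) → IsPerm σ × NotLocallyParallelToId σ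
  counted σ∈ = proj₂ (∈-filter⁻ NotLPId? {xs = allVecs n n} σ∈)
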